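{- For every integer $n\ge 1$, as formal power series in $x$, $$(c_2 c_3+c_3 c_1+c_1 c_2)^n (e^{\alpha x}+e^{\beta x}+ e^{\gamma x})=\left(\frac{ -1}{22}\right)^n\sum_{k=0}^\infty T_k^{(3,1,3)}\frac{x^k}{k!}.$$
   Context: Let $\alpha,\beta,\gamma$ be the three distinct complex roots of $x^3-x^2-x-1=0$, and set $c_1=\frac{\alpha}{(\alpha-\beta)(\alpha-\gamma)}$, $c_2=\frac{\beta}{(\beta-\alpha)(\beta-\gamma)}$, $c_3=\frac{\gamma}{(\gamma-\alpha)(\gamma-\beta)}$. For numbers $s_0,s_1,s_2$, the sequence $T_k^{(s_0,s_1,s_2)}$ is defined by $T_0^{(s_0,s_1,s_2)}=s_0$, $T_1^{(s_0,s_1,s_2)}=s_1$, $T_2^{(s_0,s_1,s_2)}=s_2$ and $T_k^{(s_0,s_1,s_2)}=T_{k-1}^{(s_0,s_1,s_2)}+T_{k-2}^{(s_0,s_1,s_2)}+T_{k-3}^{(s_0,s_1,s_2)}$ for $k\ge3$. -}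

module Defs where

open import Level using (Level; _⊔_) renaming (suc to lsuc)
open import Algebra.Bundles using (CommutativeRing)
open import Relation.Nullary using (¬_)
open import Data.Nat as ℕ using (ℕ; zero; suc)
open import Data.Integer as ℤ using (ℤ; +_; -[1+_])

record Field (c ℓ : Level) : Set (lsuc (c ⊔ ℓ)) where
  field
    commutativeRing : CommutativeRing c ℓ
  open CommutativeRing commutativeRing public
  infix 8 _⁻¹
  field
    _⁻¹        : Carrier → Carrier
    ⁻¹-inverse : ∀ x → ¬ (x ≈ 0#) → x * (x ⁻¹) ≈ 1#
    0≉1        : ¬ (0# ≈ 1#)

T : ℤ → ℤ → ℤ → ℕ → ℤ
T s₀ s₁ s₂ zero = s₀
T s₀ s₁ s₂ (suc zero) = s₁
T s₀ s₁ s₂ (suc (suc zero)) = s₂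
T s₀ s₁ s₂ (suc (suc (suc k))) =
  T s₀ s₁ s₂ (suc (suc k)) ℤ.+ T s₀ s₁ s₂ (suc k) ℤ.+ T s₀ s₁ s₂ k

module FieldNotions {c ℓ : Level} (F : Field c ℓ) where
  open Field F

  ιℕ : ℕ → Carrier
  ιℕ zero = 0#
  ιℕ (suc n) = 1# + ιℕ n

  ιℤ : ℤ → Carrier
  ιℤ (+ n) = ιℕ n
  ιℤ -[1+ n ] = - ιℕ (suc n)

  infixr 9 _^_
  _^_ : Carrier → ℕ → Carrier
  x ^ zero = 1#
  x ^ suc n = x * (x ^ n)

  CharacteristicZero : Set ℓ
  CharacteristicZero = ∀ n → ¬ (ιℕ (suc n) ≈ 0#)

  IsTribRoot : Carrier → Set ℓ
  IsTribRoot x = (x ^ 3) - (x ^ 2) - x - 1# ≈ 0#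

  cCoeff : Carrier → Carrier → Carrier → Carrier
  cCoeff a b d = a * (((a - b) * (a - d)) ⁻¹)

  infix 4 _≈ₛ_
  infixl 6 _⊕_
  infixr 7 _·ₛ_

  FPS : Set c
  FPS = ℕ → Carrier

  _≈ₛ_ : FPS → FPS → Set ℓ
  f ≈ₛ g = ∀ k → f k ≈ g k

  _⊕_ : FPS → FPS → FPS
  (f ⊕ g) k = f k + g k

  _·ₛ_ : Carrier → FPS → FPS
  (a ·ₛ f) k = a * f k

  expS : Carrier → FPS
  expS a k = (a ^ k) * (ιℕ (k ℕ.!) ⁻¹)

  egf : (ℕ → ℤ) → FPS
  egf s k = ιℤ (s k) * (ιℕ (k ℕ.!) ⁻¹)

-- Vieta's formulas give e₁ = 1, e₂ = -1, e₃ = 1 for the roots α, β, γ. Hence the power sums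
-- α^k + β^k + γ^k satisfy the tribonacci recurrence with initial values 3, e₁ = 1 and
-- e₁² - 2e₂ = 3, i.e. e^{αx} + e^{βx} + e^{γx} is the exponential generating function of T^{(3,1,3)}.
-- For the constant, write Dᵢ for the denominator of cᵢ: then (c₂c₃ + c₃c₁ + c₁c₂) D₁D₂D₃ =
-- D₁βγ + D₂γα + D₃αβ = e₂² - 3e₁e₃ = -2, while D₁D₂D₃ is minus the discriminant, 44.

{-# OPTIONS --safe #-}
module Submission where

open import Defs
open import Level using (Level)
open import Relation.Nullary using (¬_; yes; no)
open import Data.Nat as ℕ using (ℕ; zero; suc; _≤_)
open import Data.Integer as ℤ using (ℤ; +_; -[1+_])
import Data.Nat.Properties as ℕ
import Data.Integer.Properties as ℤ
open import Data.Sign as Sign using (Sign)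
open import Data.Maybe using (Maybe; just; nothing)
open import Data.Product using (_,_; proj₁; proj₂) renaming (_×_ to _∧_)
open import Relation.Binary.PropositionalEquality as ≡ using (_≡_)
open import Algebra.Solver.Ring.AlmostCommutativeRing
  using (fromCommutativeRing; _-Raw-AlmostCommutative⟶_)
import Algebra.Properties.Ring as RingProperties
import Algebra.Properties.Semiring.Mult as SemiringMult
import Algebra.Properties.CommutativeSemigroup as CommutativeSemigroupProperties
import Relation.Binary.Reasoning.Setoid as SetoidReasoning

module _ {c ℓ : Level} (F : Field c ℓ) where
  open Field F
  open FieldNotions F
  open RingProperties ring using (-‿involutive; -0#≈0#; -‿+-comm; -1*x≈-x; x∙y⁻¹≈ε⇒x≈y; x≈y⇒x∙y⁻¹≈ε)
  open SemiringMult semiring using (_×_; ×-homo-+; ×1-homo-*)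
  open CommutativeSemigroupProperties *-commutativeSemigroup using (interchange)
  open SetoidReasoning setoid

  ιℕ≡×1# : ∀ n → ιℕ n ≡ n × 1#
  ιℕ≡×1# zero = ≡.refl
  ιℕ≡×1# (suc n) = ≡.cong (_+_ 1#) (ιℕ≡×1# n)

  ιℕ-+ : ∀ m n → ιℕ (m ℕ.+ n) ≈ ιℕ m + ιℕ n
  ιℕ-+ m n rewrite ιℕ≡×1# (m ℕ.+ n) | ιℕ≡×1# m | ιℕ≡×1# n = ×-homo-+ 1# m n

  ιℕ-* : ∀ m n → ιℕ (m ℕ.* n) ≈ ιℕ m * ιℕ n
  ιℕ-* m n rewrite ιℕ≡×1# (m ℕ.* n) | ιℕ≡×1# m | ιℕ≡×1# n = ×1-homo-* m n

  [z+x]-[z+y]≈x-y : ∀ x y z → (z + x) - (z + y) ≈ x - y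
  [z+x]-[z+y]≈x-y x y z = begin
    (z + x) - (z + y)      ≈⟨ +-cong (+-comm x z) (-‿+-comm z y) ⟨
    (x + z) + (- z + - y)  ≈⟨ +-assoc x z (- z + - y) ⟩
    x + (z + (- z + - y))  ≈⟨ +-congˡ (+-assoc z (- z) (- y)) ⟨
    x + ((z - z) + - y)    ≈⟨ +-congˡ (+-congʳ (-‿inverseʳ z)) ⟩
    x + (0# + - y)         ≈⟨ +-congˡ (+-identityˡ (- y)) ⟩
    x - y                  ∎

  ιℤ-⊖ : ∀ m n → ιℤ (m ℤ.⊖ n) ≈ ιℕ m - ιℕ n
  ιℤ-⊖ m zero = sym (trans (+-congˡ -0#≈0#) (+-identityʳ (ιℕ m)))
  ιℤ-⊖ zero (suc n) = sym (+-identityˡ _)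
  ιℤ-⊖ (suc m) (suc n) = begin
    ιℤ (suc m ℤ.⊖ suc n)       ≡⟨ ≡.cong ιℤ (ℤ.[1+m]⊖[1+n]≡m⊖n m n) ⟩
    ιℤ (m ℤ.⊖ n)               ≈⟨ ιℤ-⊖ m n ⟩
    ιℕ m - ιℕ n                ≈⟨ [z+x]-[z+y]≈x-y (ιℕ m) (ιℕ n) 1# ⟨
    (1# + ιℕ m) - (1# + ιℕ n)  ∎

  ιℤ-+ : ∀ i j → ιℤ (i ℤ.+ j) ≈ ιℤ i + ιℤ j
  ιℤ-+ (+ m) (+ n) = ιℕ-+ m n
  ιℤ-+ (+ m) -[1+ n ] = ιℤ-⊖ m (suc n)
  ιℤ-+ -[1+ m ] (+ n) = trans (ιℤ-⊖ n (suc m)) (+-comm _ _)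
  ιℤ-+ -[1+ m ] -[1+ n ] = begin
    - ιℕ (suc (suc (m ℕ.+ n)))   ≡⟨ ≡.cong (λ k → - ιℕ (suc k)) (ℕ.+-suc m n) ⟨
    - ιℕ (suc m ℕ.+ suc n)       ≈⟨ -‿cong (ιℕ-+ (suc m) (suc n)) ⟩
    - (ιℕ (suc m) + ιℕ (suc n))  ≈⟨ -‿+-comm _ _ ⟨
    - ιℕ (suc m) - ιℕ (suc n)    ∎

  ιℤ-neg : ∀ i → ιℤ (ℤ.- i) ≈ - ιℤ i
  ιℤ-neg (+ zero) = sym -0#≈0#
  ιℤ-neg (+ suc n) = refl
  ιℤ-neg -[1+ n ] = sym (-‿involutive _)

  ιₛ : Sign → Carrier
  ιₛ Sign.+ = 1#
  ιₛ Sign.- = - 1#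

  ιₛ-* : ∀ s t → ιₛ (s Sign.* t) ≈ ιₛ s * ιₛ t
  ιₛ-* Sign.+ t = sym (*-identityˡ (ιₛ t))
  ιₛ-* Sign.- Sign.+ = sym (*-identityʳ (- 1#))
  ιₛ-* Sign.- Sign.- = sym (trans (-1*x≈-x (- 1#)) (-‿involutive 1#))

  ιℤ-◃ : ∀ s n → ιℤ (s ℤ.◃ n) ≈ ιₛ s * ιℕ n
  ιℤ-◃ s zero = sym (zeroʳ (ιₛ s))
  ιℤ-◃ Sign.+ (suc n) = sym (*-identityˡ _)
  ιℤ-◃ Sign.- (suc n) = sym (-1*x≈-x _)

  ιℤ≈sign*abs : ∀ i → ιℤ i ≈ ιₛ (ℤ.sign i) * ιℕ ℤ.∣ i ∣
  ιℤ≈sign*abs i = trans (reflexive (≡.cong ιℤ (≡.sym (ℤ.◃-inverse i)))) (ιℤ-◃ (ℤ.sign i) ℤ.∣ i ∣)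

  ιℤ-* : ∀ i j → ιℤ (i ℤ.* j) ≈ ιℤ i * ιℤ j
  ιℤ-* i j = begin
    ιℤ (ℤ.sign i Sign.* ℤ.sign j ℤ.◃ ℤ.∣ i ∣ ℕ.* ℤ.∣ j ∣)
      ≈⟨ ιℤ-◃ (ℤ.sign i Sign.* ℤ.sign j) (ℤ.∣ i ∣ ℕ.* ℤ.∣ j ∣) ⟩
    ιₛ (ℤ.sign i Sign.* ℤ.sign j) * ιℕ (ℤ.∣ i ∣ ℕ.* ℤ.∣ j ∣)
      ≈⟨ *-cong (ιₛ-* (ℤ.sign i) (ℤ.sign j)) (ιℕ-* ℤ.∣ i ∣ ℤ.∣ j ∣) ⟩
    (ιₛ (ℤ.sign i) * ιₛ (ℤ.sign j)) * (ιℕ ℤ.∣ i ∣ * ιℕ ℤ.∣ j ∣)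
      ≈⟨ interchange _ _ _ _ ⟩
    (ιₛ (ℤ.sign i) * ιℕ ℤ.∣ i ∣) * (ιₛ (ℤ.sign j) * ιℕ ℤ.∣ j ∣)
      ≈⟨ *-cong (ιℤ≈sign*abs i) (ιℤ≈sign*abs j) ⟨
    ιℤ i * ιℤ j ∎

  ιℤ-morphism : ℤ.+-*-rawRing -Raw-AlmostCommutative⟶ fromCommutativeRing commutativeRing
  ιℤ-morphism = record
    { ⟦_⟧    = ιℤ
    ; +-homo = ιℤ-+
    ; *-homo = ιℤ-*
    ; -‿homo = ιℤ-neg
    ; 0-homo = refl
    ; 1-homo = +-identityʳ 1#
    }

  ιℤ-≈? : ∀ i j → Maybe (ιℤ i ≈ ιℤ j)
  ιℤ-≈? i j with i ℤ.≟ j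
  ... | yes ≡.refl = just refl
  ... | no _ = nothing

  open import Algebra.Solver.Ring ℤ.+-*-rawRing (fromCommutativeRing commutativeRing) ιℤ-morphism ιℤ-≈?
    using (Polynomial; con; _:+_; _:-_; _:*_; :-_; _:^_; _:=_; solve)

  +-pres-≈0 : ∀ {x y} → x ≈ 0# → y ≈ 0# → x + y ≈ 0#
  +-pres-≈0 x≈0 y≈0 = trans (+-cong x≈0 y≈0) (+-identityʳ 0#)

  -‿pres-≈0 : ∀ {x} → x ≈ 0# → - x ≈ 0#
  -‿pres-≈0 x≈0 = trans (-‿cong x≈0) -0#≈0#

  *-presˡ-≈0 : ∀ {x} y → x ≈ 0# → x * y ≈ 0#
  *-presˡ-≈0 y x≈0 = trans (*-congʳ x≈0) (zeroˡ y)

  *-presʳ-≈0 : ∀ x {y} → y ≈ 0# → x * y ≈ 0#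
  *-presʳ-≈0 x y≈0 = trans (*-congˡ y≈0) (zeroʳ x)

  x*y≈0⇒y≈0 : ∀ {x y} → ¬ x ≈ 0# → x * y ≈ 0# → y ≈ 0#
  x*y≈0⇒y≈0 {x} {y} x≉0 xy≈0 = begin
    y               ≈⟨ *-identityˡ y ⟨
    1# * y          ≈⟨ *-congʳ (trans (*-comm (x ⁻¹) x) (⁻¹-inverse x x≉0)) ⟨
    (x ⁻¹ * x) * y  ≈⟨ *-assoc (x ⁻¹) x y ⟩
    x ⁻¹ * (x * y)  ≈⟨ *-presʳ-≈0 (x ⁻¹) xy≈0 ⟩
    0#              ∎

  x≉0∧y≉0⇒x*y≉0 : ∀ {x y} → ¬ x ≈ 0# → ¬ y ≈ 0# → ¬ x * y ≈ 0#
  x≉0∧y≉0⇒x*y≉0 x≉0 y≉0 xy≈0 = y≉0 (x*y≈0⇒y≈0 x≉0 xy≈0)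

  x≉y⇒x-y≉0 : ∀ {x y} → ¬ x ≈ y → ¬ x - y ≈ 0#
  x≉y⇒x-y≉0 x≉y x-y≈0 = x≉y (x∙y⁻¹≈ε⇒x≈y _ _ x-y≈0)

  ax+b≈0⇒x≈-b/a : ∀ {a x b} → ¬ a ≈ 0# → a * x + b ≈ 0# → x ≈ - b * a ⁻¹
  ax+b≈0⇒x≈-b/a {a} {x} {b} a≉0 ax+b≈0 = begin
    x                                   ≈⟨ trans (*-congˡ (⁻¹-inverse a a≉0)) (*-identityʳ x) ⟨
    x * (a * a ⁻¹)                      ≈⟨ split a x b (a ⁻¹) ⟩
    (a * x + b) * a ⁻¹ + - b * a ⁻¹     ≈⟨ +-congʳ (*-presˡ-≈0 (a ⁻¹) ax+b≈0) ⟩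
    0# + - b * a ⁻¹                     ≈⟨ +-identityˡ _ ⟩
    - b * a ⁻¹                          ∎
    where
    split : ∀ a x b i → x * (a * i) ≈ (a * x + b) * i + - b * i
    split = solve 4 (λ a x b i → x :* (a :* i) := (a :* x :+ b) :* i :+ :- b :* i) refl

  ^-congˡ : ∀ {x y} n → x ≈ y → x ^ n ≈ y ^ n
  ^-congˡ zero x≈y = refl
  ^-congˡ (suc n) x≈y = *-cong x≈y (^-congˡ n x≈y)

  ·ₛ-cong : ∀ {a b f g} → a ≈ b → f ≈ₛ g → a ·ₛ f ≈ₛ b ·ₛ g
  ·ₛ-cong a≈b f≈g k = *-cong a≈b (f≈g k)

  -- e₂ is ordered so that e₂ c₁ c₂ c₃ is literally c₂c₃ + c₃c₁ + c₁c₂.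
  e₁ e₂ e₃ : Carrier → Carrier → Carrier → Carrier
  e₁ a b g = a + b + g
  e₂ a b g = b * g + g * a + a * b
  e₃ a b g = a * b * g

  cubic : Carrier → Carrier → Carrier → Carrier → Carrier
  cubic s₁ s₂ s₃ x = x ^ 3 - s₁ * x ^ 2 + s₂ * x - s₃

  quadratic : Carrier → Carrier → Carrier → Carrier → Carrier
  quadratic u v w x = u * (x * x) + v * x + w

  -- The discriminant of x³ - p x² + q x - r.
  discriminant : Carrier → Carrier → Carrier → Carrier
  discriminant p q r =
    p * p * q * q - ιℕ 4 * (q * q * q) - ιℕ 4 * (p * p * p * r) + ιℕ 18 * (p * q * r) - ιℕ 27 * (r * r)

  discriminant-cong : ∀ {p p′ q q′ r r′} → p ≈ p′ → q ≈ q′ → r ≈ r′ →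
    discriminant p q r ≈ discriminant p′ q′ r′
  discriminant-cong p≈ q≈ r≈ = +-cong (+-cong (+-cong (+-cong
    (*-cong (*-cong (*-cong p≈ p≈) q≈) q≈)
    (-‿cong (*-congˡ (*-cong (*-cong q≈ q≈) q≈))))
    (-‿cong (*-congˡ (*-cong (*-cong (*-cong p≈ p≈) p≈) r≈))))
    (*-congˡ (*-cong (*-cong p≈ q≈) r≈)))
    (-‿cong (*-congˡ (*-cong r≈ r≈)))

  -- Solver syntax for the definitions above; the solver's semantics unfolds to them definitionally.
  :e₁ :e₂ :e₃ : ∀ {n} → Polynomial n → Polynomial n → Polynomial n → Polynomial n
  :e₁ a b g = a :+ b :+ g
  :e₂ a b g = b :* g :+ g :* a :+ a :* b
  :e₃ a b g = a :* b :* g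

  :cubic :quadratic : ∀ {n} → Polynomial n → Polynomial n → Polynomial n → Polynomial n → Polynomial n
  :cubic s₁ s₂ s₃ x = x :^ 3 :- s₁ :* x :^ 2 :+ s₂ :* x :- s₃
  :quadratic u v w x = u :* (x :* x) :+ v :* x :+ w

  :discriminant : ∀ {n} → Polynomial n → Polynomial n → Polynomial n → Polynomial n
  :discriminant p q r =
    p :* p :* q :* q :- con (+ 4) :* (q :* q :* q) :- con (+ 4) :* (p :* p :* p :* r)
    :+ con (+ 18) :* (p :* q :* r) :- con (+ 27) :* (r :* r)

  linear-roots : ∀ {v w a b} → ¬ a ≈ b → v * a + w ≈ 0# → v * b + w ≈ 0# → v ≈ 0# ∧ w ≈ 0#
  linear-roots {v} {w} {a} {b} a≉b la lb = v≈0 , w≈0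
    where
    difference : ∀ v w a b → (a - b) * v ≈ (v * a + w) - (v * b + w)
    difference = solve 4 (λ v w a b → (a :- b) :* v := (v :* a :+ w) :- (v :* b :+ w)) refl
    constant : ∀ v w a → w ≈ (v * a + w) - v * a
    constant = solve 3 (λ v w a → w := (v :* a :+ w) :- v :* a) refl
    v≈0 : v ≈ 0#
    v≈0 = x*y≈0⇒y≈0 (x≉y⇒x-y≉0 a≉b) (trans (difference v w a b) (+-pres-≈0 la (-‿pres-≈0 lb)))
    w≈0 : w ≈ 0#
    w≈0 = trans (constant v w a) (+-pres-≈0 la (-‿pres-≈0 (*-presˡ-≈0 a v≈0)))

  quadratic-roots : ∀ {u v w a b g} → ¬ a ≈ b → ¬ b ≈ g → ¬ a ≈ g →
    quadratic u v w a ≈ 0# → quadratic u v w b ≈ 0# → quadratic u v w g ≈ 0# →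
    u ≈ 0# ∧ v ≈ 0# ∧ w ≈ 0#
  quadratic-roots {u} {v} {w} {a} {b} {g} a≉b b≉g a≉g qa qb qg =
    u≈0 , linear-roots a≉b (trans (sym (linear a)) qa) (trans (sym (linear b)) qb)
    where
    divided-difference : ∀ u v w a b g →
      (a - b) * (a - g) * (b - g) * u
        ≈ (b - g) * quadratic u v w a - (a - g) * quadratic u v w b + (a - b) * quadratic u v w g
    divided-difference = solve 6 (λ u v w a b g →
      (a :- b) :* (a :- g) :* (b :- g) :* u
        := (b :- g) :* :quadratic u v w a :- (a :- g) :* :quadratic u v w b :+ (a :- b) :* :quadratic u v w g) refl
    u≈0 : u ≈ 0#
    u≈0 = x*y≈0⇒y≈0
      (x≉0∧y≉0⇒x*y≉0 (x≉0∧y≉0⇒x*y≉0 (x≉y⇒x-y≉0 a≉b) (x≉y⇒x-y≉0 a≉g)) (x≉y⇒x-y≉0 b≉g))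
      (trans (divided-difference u v w a b g)
        (+-pres-≈0 (+-pres-≈0 (*-presʳ-≈0 _ qa) (-‿pres-≈0 (*-presʳ-≈0 _ qb))) (*-presʳ-≈0 _ qg)))
    linear : ∀ x → quadratic u v w x ≈ v * x + w
    linear x = +-congʳ (trans (+-congʳ (*-presˡ-≈0 (x * x) u≈0)) (+-identityˡ (v * x)))

  cubic≈linearFactors+quadratic : ∀ s₁ s₂ s₃ a b g x →
    cubic s₁ s₂ s₃ x
      ≈ (x - a) * (x - b) * (x - g) + quadratic (e₁ a b g - s₁) (s₂ - e₂ a b g) (e₃ a b g - s₃) x
  cubic≈linearFactors+quadratic = solve 7 (λ s₁ s₂ s₃ a b g x →
    :cubic s₁ s₂ s₃ x
      := (x :- a) :* (x :- b) :* (x :- g) :+ :quadratic (:e₁ a b g :- s₁) (s₂ :- :e₂ a b g) (:e₃ a b g :- s₃) x) refl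

  vieta : ∀ {s₁ s₂ s₃ a b g} → ¬ a ≈ b → ¬ b ≈ g → ¬ a ≈ g →
    cubic s₁ s₂ s₃ a ≈ 0# → cubic s₁ s₂ s₃ b ≈ 0# → cubic s₁ s₂ s₃ g ≈ 0# →
    e₁ a b g ≈ s₁ ∧ e₂ a b g ≈ s₂ ∧ e₃ a b g ≈ s₃
  vieta {s₁} {s₂} {s₃} {a} {b} {g} a≉b b≉g a≉g ca cb cg =
    x∙y⁻¹≈ε⇒x≈y _ _ U≈0 , sym (x∙y⁻¹≈ε⇒x≈y _ _ V≈0) , x∙y⁻¹≈ε⇒x≈y _ _ W≈0
    where
    U V W : Carrier
    U = e₁ a b g - s₁
    V = s₂ - e₂ a b g
    W = e₃ a b g - s₃
    remainder-root : ∀ {x} → cubic s₁ s₂ s₃ x ≈ 0# → (x - a) * (x - b) * (x - g) ≈ 0# →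
      quadratic U V W x ≈ 0#
    remainder-root {x} cx px = begin
      quadratic U V W x                                ≈⟨ +-identityˡ _ ⟨
      0# + quadratic U V W x                           ≈⟨ +-congʳ px ⟨
      (x - a) * (x - b) * (x - g) + quadratic U V W x  ≈⟨ cubic≈linearFactors+quadratic s₁ s₂ s₃ a b g x ⟨
      cubic s₁ s₂ s₃ x                                 ≈⟨ cx ⟩
      0#                                               ∎
    U≈0∧V≈0∧W≈0 : U ≈ 0# ∧ V ≈ 0# ∧ W ≈ 0#
    U≈0∧V≈0∧W≈0 = quadratic-roots a≉b b≉g a≉g
      (remainder-root ca (*-presˡ-≈0 (a - g) (*-presˡ-≈0 (a - b) (-‿inverseʳ a))))
      (remainder-root cb (*-presˡ-≈0 (b - g) (*-presʳ-≈0 (b - a) (-‿inverseʳ b))))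
      (remainder-root cg (*-presʳ-≈0 ((g - a) * (g - b)) (-‿inverseʳ g)))
    U≈0 : U ≈ 0#
    U≈0 = proj₁ U≈0∧V≈0∧W≈0
    V≈0 : V ≈ 0#
    V≈0 = proj₁ (proj₂ U≈0∧V≈0∧W≈0)
    W≈0 : W ≈ 0#
    W≈0 = proj₂ (proj₂ U≈0∧V≈0∧W≈0)

  IsTribonacci : (ℕ → Carrier) → Set ℓ
  IsTribonacci u = ∀ k → u (3 ℕ.+ k) ≈ u (2 ℕ.+ k) + u (1 ℕ.+ k) + u k

  IsTribonacci-⊕ : ∀ {u v} → IsTribonacci u → IsTribonacci v → IsTribonacci (u ⊕ v)
  IsTribonacci-⊕ tu tv k = trans (+-cong (tu k) (tv k)) (regroup _ _ _ _ _ _)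
    where
    regroup : ∀ x₂ x₁ x₀ y₂ y₁ y₀ → (x₂ + x₁ + x₀) + (y₂ + y₁ + y₀) ≈ (x₂ + y₂) + (x₁ + y₁) + (x₀ + y₀)
    regroup = solve 6 (λ x₂ x₁ x₀ y₂ y₁ y₀ →
      (x₂ :+ x₁ :+ x₀) :+ (y₂ :+ y₁ :+ y₀) := (x₂ :+ y₂) :+ (x₁ :+ y₁) :+ (x₀ :+ y₀)) refl

  IsTribonacci⇒≈ιℤ∘T : ∀ {u s₀ s₁ s₂} → IsTribonacci u →
    u 0 ≈ ιℤ s₀ → u 1 ≈ ιℤ s₁ → u 2 ≈ ιℤ s₂ → ∀ k → u k ≈ ιℤ (T s₀ s₁ s₂ k)
  IsTribonacci⇒≈ιℤ∘T tu u₀ u₁ u₂ zero = u₀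
  IsTribonacci⇒≈ιℤ∘T tu u₀ u₁ u₂ (suc zero) = u₁
  IsTribonacci⇒≈ιℤ∘T tu u₀ u₁ u₂ (suc (suc zero)) = u₂
  IsTribonacci⇒≈ιℤ∘T {u} {s₀} {s₁} {s₂} tu u₀ u₁ u₂ (suc (suc (suc k))) = begin
    u (3 ℕ.+ k)                                     ≈⟨ tu k ⟩
    u (2 ℕ.+ k) + u (1 ℕ.+ k) + u k                 ≈⟨ +-cong (+-cong
                                                         (IsTribonacci⇒≈ιℤ∘T tu u₀ u₁ u₂ (suc (suc k)))
                                                         (IsTribonacci⇒≈ιℤ∘T tu u₀ u₁ u₂ (suc k)))
                                                         (IsTribonacci⇒≈ιℤ∘T tu u₀ u₁ u₂ k) ⟩
    ιℤ (t (2 ℕ.+ k)) + ιℤ (t (1 ℕ.+ k)) + ιℤ (t k)  ≈⟨ trans (ιℤ-+ (t (2 ℕ.+ k) ℤ.+ t (1 ℕ.+ k)) (t k))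
                                                         (+-congʳ (ιℤ-+ (t (2 ℕ.+ k)) (t (1 ℕ.+ k)))) ⟨
    ιℤ (t (3 ℕ.+ k))                                ∎
    where
    t : ℕ → ℤ
    t = T s₀ s₁ s₂

  tribRoot⇒cubic≈0 : ∀ {x} → IsTribRoot x → cubic (ιℕ 1) (- ιℕ 1) (ιℕ 1) x ≈ 0#
  tribRoot⇒cubic≈0 {x} root = begin
    cubic (ιℕ 1) (- ιℕ 1) (ιℕ 1) x  ≈⟨ expand x ⟩
    x ^ 3 - x ^ 2 - x - ιℕ 1        ≈⟨ +-congˡ (-‿cong (+-identityʳ 1#)) ⟩
    x ^ 3 - x ^ 2 - x - 1#          ≈⟨ root ⟩
    0#                              ∎
    where
    expand : ∀ x → cubic (ιℕ 1) (- ιℕ 1) (ιℕ 1) x ≈ x ^ 3 - x ^ 2 - x - ιℕ 1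
    expand = solve 1 (λ x →
      :cubic (con (+ 1)) (:- con (+ 1)) (con (+ 1)) x := x :^ 3 :- x :^ 2 :- x :- con (+ 1)) refl

  tribRoot⇒IsTribonacci-^ : ∀ {x} → IsTribRoot x → IsTribonacci (x ^_)
  tribRoot⇒IsTribonacci-^ {x} root k = begin
    x ^ (3 ℕ.+ k)                                                   ≈⟨ shift x (x ^ k) ⟩
    x ^ (2 ℕ.+ k) + x ^ (1 ℕ.+ k) + x ^ k + cubic (ιℕ 1) (- ιℕ 1) (ιℕ 1) x * x ^ k
      ≈⟨ +-congˡ (*-presˡ-≈0 (x ^ k) (tribRoot⇒cubic≈0 root)) ⟩
    x ^ (2 ℕ.+ k) + x ^ (1 ℕ.+ k) + x ^ k + 0#                      ≈⟨ +-identityʳ _ ⟩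
    x ^ (2 ℕ.+ k) + x ^ (1 ℕ.+ k) + x ^ k                           ∎
    where
    shift : ∀ x y → x * (x * (x * y)) ≈ x * (x * y) + x * y + y + cubic (ιℕ 1) (- ιℕ 1) (ιℕ 1) x * y
    shift = solve 2 (λ x y → x :* (x :* (x :* y))
      := x :* (x :* y) :+ x :* y :+ y :+ :cubic (con (+ 1)) (:- con (+ 1)) (con (+ 1)) x :* y) refl

  tribRoots-powerSum≈T : ∀ {a b g} → IsTribRoot a → IsTribRoot b → IsTribRoot g →
    e₁ a b g ≈ ιℕ 1 → e₂ a b g ≈ - ιℕ 1 →
    ∀ k → a ^ k + b ^ k + g ^ k ≈ ιℤ (T (+ 3) (+ 1) (+ 3) k)
  tribRoots-powerSum≈T {a} {b} {g} ra rb rg e₁≈1 e₂≈-1 =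
    IsTribonacci⇒≈ιℤ∘T
      (IsTribonacci-⊕ (IsTribonacci-⊕ (tribRoot⇒IsTribonacci-^ ra) (tribRoot⇒IsTribonacci-^ rb))
                      (tribRoot⇒IsTribonacci-^ rg))
      p₀ p₁ p₂
    where
    p₀ : 1# + 1# + 1# ≈ ιℕ 3
    p₀ = trans (+-assoc 1# 1# 1#) (+-congˡ (+-congˡ (sym (+-identityʳ 1#))))
    p₁ : a * 1# + b * 1# + g * 1# ≈ ιℕ 1
    p₁ = trans (+-cong (+-cong (*-identityʳ a) (*-identityʳ b)) (*-identityʳ g)) e₁≈1
    newton : ∀ a b g → a ^ 2 + b ^ 2 + g ^ 2 ≈ e₁ a b g * e₁ a b g - ιℕ 2 * e₂ a b g
    newton = solve 3 (λ a b g →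
      a :^ 2 :+ b :^ 2 :+ g :^ 2 := :e₁ a b g :* :e₁ a b g :- con (+ 2) :* :e₂ a b g) refl
    evaluate : ιℕ 1 * ιℕ 1 - ιℕ 2 * - ιℕ 1 ≈ ιℕ 3
    evaluate = solve 0 (con (+ 1) :* con (+ 1) :- con (+ 2) :* :- con (+ 1) := con (+ 3)) refl
    p₂ : a ^ 2 + b ^ 2 + g ^ 2 ≈ ιℕ 3
    p₂ = begin
      a ^ 2 + b ^ 2 + g ^ 2                              ≈⟨ newton a b g ⟩
      e₁ a b g * e₁ a b g - ιℕ 2 * e₂ a b g              ≈⟨ +-cong (*-cong e₁≈1 e₁≈1) (-‿cong (*-congˡ e₂≈-1)) ⟩
      ιℕ 1 * ιℕ 1 - ιℕ 2 * - ιℕ 1                        ≈⟨ evaluate ⟩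
      ιℕ 3                                               ∎

  cDenom : Carrier → Carrier → Carrier → Carrier
  cDenom a b d = (a - b) * (a - d)

  cCoeff*cDenom : ∀ {a b d} → ¬ a ≈ b → ¬ a ≈ d → cCoeff a b d * cDenom a b d ≈ a
  cCoeff*cDenom {a} {b} {d} a≉b a≉d = begin
    a * D ⁻¹ * D    ≈⟨ *-assoc a (D ⁻¹) D ⟩
    a * (D ⁻¹ * D)  ≈⟨ *-congˡ (trans (*-comm (D ⁻¹) D) (⁻¹-inverse D D≉0)) ⟩
    a * 1#          ≈⟨ *-identityʳ a ⟩
    a               ∎
    where
    D : Carrier
    D = cDenom a b d
    D≉0 : ¬ D ≈ 0#
    D≉0 = x≉0∧y≉0⇒x*y≉0 (x≉y⇒x-y≉0 a≉b) (x≉y⇒x-y≉0 a≉d)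

  e₂-*-product : ∀ c₁ c₂ c₃ D₁ D₂ D₃ →
    e₂ c₁ c₂ c₃ * (D₁ * D₂ * D₃)
      ≈ D₁ * ((c₂ * D₂) * (c₃ * D₃)) + D₂ * ((c₃ * D₃) * (c₁ * D₁)) + D₃ * ((c₁ * D₁) * (c₂ * D₂))
  e₂-*-product = solve 6 (λ c₁ c₂ c₃ D₁ D₂ D₃ →
    :e₂ c₁ c₂ c₃ :* (D₁ :* D₂ :* D₃)
      := D₁ :* ((c₂ :* D₂) :* (c₃ :* D₃)) :+ D₂ :* ((c₃ :* D₃) :* (c₁ :* D₁)) :+ D₃ :* ((c₁ :* D₁) :* (c₂ :* D₂))) refl

  cDenom-pairs≈e₂²-3e₁e₃ : ∀ a b g →
    cDenom a b g * (b * g) + cDenom b a g * (g * a) + cDenom g a b * (a * b)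
      ≈ e₂ a b g * e₂ a b g - ιℕ 3 * (e₁ a b g * e₃ a b g)
  cDenom-pairs≈e₂²-3e₁e₃ = solve 3 (λ a b g →
    (a :- b) :* (a :- g) :* (b :* g) :+ (b :- a) :* (b :- g) :* (g :* a) :+ (g :- a) :* (g :- b) :* (a :* b)
      := :e₂ a b g :* :e₂ a b g :- con (+ 3) :* (:e₁ a b g :* :e₃ a b g)) refl

  cDenom-product≈-discriminant : ∀ a b g →
    cDenom a b g * cDenom b a g * cDenom g a b ≈ - discriminant (e₁ a b g) (e₂ a b g) (e₃ a b g)
  cDenom-product≈-discriminant = solve 3 (λ a b g →
    (a :- b) :* (a :- g) :* ((b :- a) :* (b :- g)) :* ((g :- a) :* (g :- b))
      := :- :discriminant (:e₁ a b g) (:e₂ a b g) (:e₃ a b g)) refl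

  e₂-cCoeff*cDenom-product : ∀ {a b g} → ¬ a ≈ b → ¬ b ≈ g → ¬ a ≈ g →
    e₂ (cCoeff a b g) (cCoeff b a g) (cCoeff g a b) * (cDenom a b g * cDenom b a g * cDenom g a b)
      ≈ e₂ a b g * e₂ a b g - ιℕ 3 * (e₁ a b g * e₃ a b g)
  e₂-cCoeff*cDenom-product {a} {b} {g} a≉b b≉g a≉g = begin
    e₂ c₁ c₂ c₃ * (D₁ * D₂ * D₃)
      ≈⟨ e₂-*-product c₁ c₂ c₃ D₁ D₂ D₃ ⟩
    D₁ * ((c₂ * D₂) * (c₃ * D₃)) + D₂ * ((c₃ * D₃) * (c₁ * D₁)) + D₃ * ((c₁ * D₁) * (c₂ * D₂))
      ≈⟨ +-cong (+-cong (*-congˡ (*-cong c₂D₂≈b c₃D₃≈g)) (*-congˡ (*-cong c₃D₃≈g c₁D₁≈a)))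
                (*-congˡ (*-cong c₁D₁≈a c₂D₂≈b)) ⟩
    D₁ * (b * g) + D₂ * (g * a) + D₃ * (a * b)
      ≈⟨ cDenom-pairs≈e₂²-3e₁e₃ a b g ⟩
    e₂ a b g * e₂ a b g - ιℕ 3 * (e₁ a b g * e₃ a b g) ∎
    where
    c₁ c₂ c₃ D₁ D₂ D₃ : Carrier
    c₁ = cCoeff a b g
    c₂ = cCoeff b a g
    c₃ = cCoeff g a b
    D₁ = cDenom a b g
    D₂ = cDenom b a g
    D₃ = cDenom g a b
    c₁D₁≈a : c₁ * D₁ ≈ a
    c₁D₁≈a = cCoeff*cDenom a≉b a≉g
    c₂D₂≈b : c₂ * D₂ ≈ b
    c₂D₂≈b = cCoeff*cDenom (λ b≈a → a≉b (sym b≈a)) b≉g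
    c₃D₃≈g : c₃ * D₃ ≈ g
    c₃D₃≈g = cCoeff*cDenom (λ g≈a → a≉g (sym g≈a)) (λ g≈b → b≉g (sym g≈b))

  e₂-cCoeff≈-1/22 : CharacteristicZero → ∀ {a b g} → ¬ a ≈ b → ¬ b ≈ g → ¬ a ≈ g →
    e₁ a b g ≈ ιℕ 1 → e₂ a b g ≈ - ιℕ 1 → e₃ a b g ≈ ιℕ 1 →
    e₂ (cCoeff a b g) (cCoeff b a g) (cCoeff g a b) ≈ - 1# * ιℕ 22 ⁻¹
  e₂-cCoeff≈-1/22 char0 {a} {b} {g} a≉b b≉g a≉g e₁≈1 e₂≈-1 e₃≈1 = begin
    S                  ≈⟨ ax+b≈0⇒x≈-b/a (char0 21) (x*y≈0⇒y≈0 (char0 1) (trans (double S) S*44+2≈0)) ⟩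
    - ιℕ 1 * ιℕ 22 ⁻¹  ≈⟨ *-congʳ (-‿cong (+-identityʳ 1#)) ⟩
    - 1# * ιℕ 22 ⁻¹    ∎
    where
    S : Carrier
    S = e₂ (cCoeff a b g) (cCoeff b a g) (cCoeff g a b)
    D : Carrier
    D = cDenom a b g * cDenom b a g * cDenom g a b
    D≈44 : D ≈ - discriminant (ιℕ 1) (- ιℕ 1) (ιℕ 1)
    D≈44 = trans (cDenom-product≈-discriminant a b g) (-‿cong (discriminant-cong e₁≈1 e₂≈-1 e₃≈1))
    S*44≈-2 : S * - discriminant (ιℕ 1) (- ιℕ 1) (ιℕ 1) ≈ - ιℕ 1 * - ιℕ 1 - ιℕ 3 * (ιℕ 1 * ιℕ 1)
    S*44≈-2 = begin
      S * - discriminant (ιℕ 1) (- ιℕ 1) (ιℕ 1)       ≈⟨ *-congˡ D≈44 ⟨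
      S * D                                           ≈⟨ e₂-cCoeff*cDenom-product a≉b b≉g a≉g ⟩
      e₂ a b g * e₂ a b g - ιℕ 3 * (e₁ a b g * e₃ a b g)
        ≈⟨ +-cong (*-cong e₂≈-1 e₂≈-1) (-‿cong (*-congˡ (*-cong e₁≈1 e₃≈1))) ⟩
      - ιℕ 1 * - ιℕ 1 - ιℕ 3 * (ιℕ 1 * ιℕ 1)          ∎
    S*44+2≈0 : S * - discriminant (ιℕ 1) (- ιℕ 1) (ιℕ 1) - (- ιℕ 1 * - ιℕ 1 - ιℕ 3 * (ιℕ 1 * ιℕ 1)) ≈ 0#
    S*44+2≈0 = x≈y⇒x∙y⁻¹≈ε S*44≈-2
    double : ∀ S → ιℕ 2 * (ιℕ 22 * S + ιℕ 1)
      ≈ S * - discriminant (ιℕ 1) (- ιℕ 1) (ιℕ 1) - (- ιℕ 1 * - ιℕ 1 - ιℕ 3 * (ιℕ 1 * ιℕ 1))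
    double = solve 1 (λ S → con (+ 2) :* (con (+ 22) :* S :+ con (+ 1))
      := S :* :- :discriminant (con (+ 1)) (:- con (+ 1)) (con (+ 1))
         :- (:- con (+ 1) :* :- con (+ 1) :- con (+ 3) :* (con (+ 1) :* con (+ 1)))) refl

  expS-sum≈egf : ∀ {a b g} s → (∀ k → a ^ k + b ^ k + g ^ k ≈ ιℤ (s k)) →
    expS a ⊕ expS b ⊕ expS g ≈ₛ egf s
  expS-sum≈egf {a} {b} {g} s powerSum k = begin
    a ^ k * i + b ^ k * i + g ^ k * i  ≈⟨ trans (distribʳ i _ _) (+-congʳ (distribʳ i _ _)) ⟨
    (a ^ k + b ^ k + g ^ k) * i        ≈⟨ *-congʳ (powerSum k) ⟩
    ιℤ (s k) * i                       ∎
    where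
    i : Carrier
    i = ιℕ (k ℕ.!) ⁻¹

theorem11 : ∀ {c ℓ : Level} (F : Field c ℓ) →
    let open Field F
        open FieldNotions F
    in CharacteristicZero →
       (α β γ : Carrier) →
       ¬ (α ≈ β) → ¬ (β ≈ γ) → ¬ (α ≈ γ) →
       IsTribRoot α → IsTribRoot β → IsTribRoot γ →
       let c₁ = cCoeff α β γ
           c₂ = cCoeff β α γ
           c₃ = cCoeff γ α β
       in ∀ (n : ℕ) → 1 ≤ n →
          (((c₂ * c₃ + c₃ * c₁ + c₁ * c₂) ^ n) ·ₛ (expS α ⊕ expS β ⊕ expS γ))
            ≈ₛ (((- 1# * (ιℕ 22 ⁻¹)) ^ n) ·ₛ egf (T (+ 3) (+ 1) (+ 3)))
-- The identity holds for n = 0 as well.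
theorem11 F char0 α β γ α≉β β≉γ α≉γ rα rβ rγ n _ =
  ·ₛ-cong F (^-congˡ F n (e₂-cCoeff≈-1/22 F char0 α≉β β≉γ α≉γ e₁≈1 e₂≈-1 e₃≈1))
            (expS-sum≈egf F (T (+ 3) (+ 1) (+ 3)) (tribRoots-powerSum≈T F rα rβ rγ e₁≈1 e₂≈-1))
  where
  open Field F
  open FieldNotions F
  e₁≈1∧e₂≈-1∧e₃≈1 : e₁ F α β γ ≈ ιℕ 1 ∧ e₂ F α β γ ≈ - ιℕ 1 ∧ e₃ F α β γ ≈ ιℕ 1
  e₁≈1∧e₂≈-1∧e₃≈1 =
    vieta F α≉β β≉γ α≉γ (tribRoot⇒cubic≈0 F rα) (tribRoot⇒cubic≈0 F rβ) (tribRoot⇒cubic≈0 F rγ)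
  e₁≈1 : e₁ F α β γ ≈ ιℕ 1
  e₁≈1 = proj₁ e₁≈1∧e₂≈-1∧e₃≈1
  e₂≈-1 : e₂ F α β γ ≈ - ιℕ 1
  e₂≈-1 = proj₁ (proj₂ e₁≈1∧e₂≈-1∧e₃≈1)
  e₃≈1 : e₃ F α β γ ≈ ιℕ 1
  e₃≈1 = proj₂ (proj₂ e₁≈1∧e₂≈-1∧e₃≈1)
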